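{- Let $J$ be any one of $J_{\mathrm{rect}}$, $J_{\mathrm{tri}}$, $J_{\mathrm{hex}}$, with corresponding lattice $L$. Let $x$ be a binary word and $m\in\mathbb N$. Suppose $J(x1)<J(x)$, and suppose there is a fold $F$ of $x$ in $L$ with score $J(x)$ that can be extended to a fold of $1^m x$ (i.e. there is a fold of $1^mx$ in $L$ whose restriction to the last $|x|$ positions is $F$). Then $J(1^m x1)<J(1^m x)$.
   Context: Words are finite strings over $\{0,1\}$ ($0$ = hydrophobic, $1$ = polar); $1^m$ is the word of $m$ ones and juxtaposition is concatenation. Lattices: the 2D rectangular lattice $\mathbb Z^2$, the triangular lattice (regular triangular tiling of the plane, 6-regular), and the hexagonal lattice (regular hexagonal tiling, 3-regular). A fold of a word $w=w_1\cdots w_n$ in a lattice is a self-avoiding walk $v_1,\dots,v_n$ (distinct vertices, $v_i$ adjacent to $v_{i+1}$); its score is the number of pairs $\{i,j\}$ with $|i-j|\ge 2$, $w_i=w_j=0$ and $v_i,v_j$ adjacent. $J_{\mathrm{rect}}, J_{\mathrm{tri}}, J_{\mathrm{hex}}$ give the maximum score over all folds of a word in the respective lattice. -}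

module Defs where

open import Data.Bool using (Bool; true; false; _∧_; _∨_; if_then_else_; T)
open import Data.Nat using (ℕ; zero; suc; _+_; _≤ᵇ_; _≡ᵇ_; _%_; _≤_)
open import Data.Integer as ℤ using (ℤ; +_; -[1+_]; ∣_∣)
open import Data.Product using (_×_; _,_; Σ; proj₁; proj₂)
open import Data.Fin using (Fin; toℕ)
open import Data.Vec using (Vec; lookup; replicate; _++_; [_])
open import Data.List as List using (List; []; _∷_; allFin; map)
open import Data.Bool.ListAction using (any)
open import Data.Nat.ListAction using (sum)
open import Relation.Binary.PropositionalEquality using (_≡_)
open import Relation.Nullary.Decidable using (⌊_⌋)

-- Letters: b0 = hydrophobic (0), b1 = polar (1).
data Bit : Set where
  b0 b1 : Bit

isZero : Bit → Bool
isZero b0 = true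
isZero b1 = false

Word : ℕ → Set
Word n = Vec Bit n

ones : (m : ℕ) → Word m
ones m = replicate m b1

data Lattice : Set where
  rect tri hex : Lattice

Vertex : Set
Vertex = ℤ × ℤ

_==_ : ℤ → ℤ → Bool
a == b = ⌊ a ℤ.≟ b ⌋

evenℤ : ℤ → Bool
evenℤ z = ∣ z ∣ % 2 ≡ᵇ 0

offsetIs : Vertex → Vertex → ℤ × ℤ → Bool
offsetIs (a , b) (c , d) (dx , dy) = ((a ℤ.+ dx) == c) ∧ ((b ℤ.+ dy) == d)

one minus1 zero' : ℤ
one = + 1
minus1 = -[1+ 0 ]
zero' = + 0

-- Neighbour offsets.
-- rect: square lattice Z^2.
-- tri : triangular lattice in axial coordinates (6 neighbours).
-- hex : hexagonal (honeycomb) lattice in brick-wall coordinates: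
--       (a,b) ~ (a±1,b), and (a,b+1) if a+b even, (a,b-1) if a+b odd (3 neighbours).
offsets : Lattice → Vertex → List (ℤ × ℤ)
offsets rect _ = (one , zero') ∷ (minus1 , zero') ∷ (zero' , one) ∷ (zero' , minus1) ∷ []
offsets tri _ = (one , zero') ∷ (minus1 , zero') ∷ (zero' , one) ∷ (zero' , minus1)
              ∷ (one , minus1) ∷ (minus1 , one) ∷ []
offsets hex (a , b) = (one , zero') ∷ (minus1 , zero')
              ∷ (if evenℤ (a ℤ.+ b) then (zero' , one) else (zero' , minus1)) ∷ []

adjB : Lattice → Vertex → Vertex → Bool
adjB L u v = any (offsetIs u v) (offsets L u)

Adj : Lattice → Vertex → Vertex → Set
Adj L u v = T (adjB L u v)

record Fold (L : Lattice) (n : ℕ) : Set where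
  field
    pos  : Fin n → Vertex
    inj  : ∀ (i j : Fin n) → pos i ≡ pos j → i ≡ j
    walk : ∀ (i j : Fin n) → suc (toℕ i) ≡ toℕ j → Adj L (pos i) (pos j)
open Fold public

-- contributes 1 to the score for ordered pairs i, j with j ≥ i + 2 (each unordered pair once)
contact : ∀ {n} (L : Lattice) → Word n → Fold L n → Fin n → Fin n → ℕ
contact L w F i j =
  if (suc (suc (toℕ i)) ≤ᵇ toℕ j) ∧ isZero (lookup w i) ∧ isZero (lookup w j)
       ∧ adjB L (pos F i) (pos F j)
  then 1 else 0

score : ∀ {n} (L : Lattice) → Word n → Fold L n → ℕ
score {n} L w F = sum (map (λ i → sum (map (λ j → contact L w F i j) (allFin n))) (allFin n))

IsJ : ∀ {n} → Lattice → Word n → ℕ → Set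
IsJ {n} L w k = Σ (Fold L n) (λ F → score L w F ≡ k) × (∀ (F : Fold L n) → score L w F ≤ k)

Extends : ∀ {n} {L : Lattice} (m : ℕ) → Fold L (m + n) → Fold L n → Set
Extends {n} m G F = ∀ (i : Fin n) → pos G (m Data.Fin.↑ʳ i) ≡ pos F i

-- Polar residues never make contacts, so the leading 1^m of a fold of 1^m y contributes nothing:
-- its score equals the score of its restriction to y.  Hence
-- J(1^m x1) ≤ J(x1) < J(x) = score(F) = score(G) ≤ J(1^m x), where G is the given extension of F.
module Submission where

open import Defs
open import Data.Nat using (ℕ; _+_; _<_)
open import Data.Vec using (_++_; [_])
open import Data.Product using (Σ; _×_)
open import Relation.Binary.PropositionalEquality using (_≡_)

open import Data.Nat using (zero; suc; _≤_; _≤ᵇ_)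
open import Data.Nat.Properties using (<-≤-trans; ≤-<-trans; +-suc; module ≤-Reasoning)
open import Data.Bool using (true; false)
open import Data.Fin as Fin using (Fin; toℕ; _↑ʳ_)
open import Data.Fin.Properties using (toℕ-↑ʳ; ↑ʳ-injective)
open import Data.Vec using (_∷_)
open import Data.List using (List; []; _∷_; allFin; map; tabulate)
open import Data.List.Properties using (map-cong; map-tabulate)
open import Data.Nat.ListAction using (sum)
open import Data.Product using (_,_; proj₂)
open import Relation.Binary.PropositionalEquality using (refl; trans; cong; cong₂; module ≡-Reasoning)

sum-map-cong : ∀ {A : Set} {f g : A → ℕ} → (∀ a → f a ≡ g a) → (l : List A) →
  sum (map f l) ≡ sum (map g l)
sum-map-cong eq l = cong sum (map-cong eq l)

sum-map-zero : ∀ {A : Set} {f : A → ℕ} → (∀ a → f a ≡ 0) → (l : List A) → sum (map f l) ≡ 0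
sum-map-zero eq []      = refl
sum-map-zero eq (a ∷ l) rewrite eq a = sum-map-zero eq l

sum-map-allFin-suc : ∀ {n} (f : Fin (suc n) → ℕ) →
  sum (map f (allFin (suc n))) ≡ f Fin.zero + sum (map (λ i → f (Fin.suc i)) (allFin n))
sum-map-allFin-suc {n} f = begin
  sum (map f (allFin (suc n)))                        ≡⟨ cong sum (map-tabulate (λ i → i) f) ⟩
  f Fin.zero + sum (tabulate (λ i → f (Fin.suc i)))   ≡⟨ cong (λ l → f Fin.zero + sum l)
                                                           (map-tabulate (λ i → i) (λ i → f (Fin.suc i))) ⟨
  f Fin.zero + sum (map (λ i → f (Fin.suc i)) (allFin n)) ∎
  where open ≡-Reasoning

restrict : ∀ {L n} (m : ℕ) → Fold L (m + n) → Fold L n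
restrict m G = record
  { pos  = λ i → pos G (m ↑ʳ i)
  ; inj  = λ i j e → ↑ʳ-injective m i j (inj G _ _ e)
  ; walk = λ i j e → walk G (m ↑ʳ i) (m ↑ʳ j) (shift i j e)
  }
  where
  shift : ∀ {n} (i j : Fin n) → suc (toℕ i) ≡ toℕ j → suc (toℕ (m ↑ʳ i)) ≡ toℕ (m ↑ʳ j)
  shift i j e = begin
    suc (toℕ (m ↑ʳ i)) ≡⟨ cong suc (toℕ-↑ʳ m i) ⟩
    suc (m + toℕ i)    ≡⟨ +-suc m (toℕ i) ⟨
    m + suc (toℕ i)    ≡⟨ cong (m +_) e ⟩
    m + toℕ j          ≡⟨ toℕ-↑ʳ m j ⟨
    toℕ (m ↑ʳ j)       ∎
    where open ≡-Reasoning

score-cong : ∀ {L n} (w : Word n) {G F : Fold L n} → (∀ i → pos G i ≡ pos F i) →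
  score L w G ≡ score L w F
score-cong {L} {n} w {G} {F} eq =
  sum-map-cong (λ i → sum-map-cong (contact-cong i) (allFin n)) (allFin n)
  where
  contact-cong : ∀ i j → contact L w G i j ≡ contact L w F i j
  contact-cong i j rewrite eq i | eq j = refl

contact-polar-head : ∀ {L n} (w : Word n) (G : Fold L (suc n)) (j : Fin (suc n)) →
  contact L (b1 ∷ w) G Fin.zero j ≡ 0
contact-polar-head w G j with 2 ≤ᵇ toℕ j
... | true  = refl
... | false = refl

-- The contacts between two later positions agree definitionally with those of the restriction.
score-polar-head : ∀ {L n} (w : Word n) (G : Fold L (suc n)) →
  score L (b1 ∷ w) G ≡ score L w (restrict 1 G)
score-polar-head {L} {n} w G = begin
  score L (b1 ∷ w) G
    ≡⟨ sum-map-allFin-suc (λ i → sum (map (contact L (b1 ∷ w) G i) (allFin (suc n)))) ⟩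
  sum (map (contact L (b1 ∷ w) G Fin.zero) (allFin (suc n)))
    + sum (map (λ i → sum (map (contact L (b1 ∷ w) G (Fin.suc i)) (allFin (suc n)))) (allFin n))
    ≡⟨ cong₂ _+_ (sum-map-zero (contact-polar-head w G) (allFin (suc n)))
                 (sum-map-cong (λ i → sum-map-allFin-suc (contact L (b1 ∷ w) G (Fin.suc i))) (allFin n)) ⟩
  score L w (restrict 1 G) ∎
  where open ≡-Reasoning

score-ones-++ : ∀ {L n} (m : ℕ) (w : Word n) (G : Fold L (m + n)) →
  score L (ones m ++ w) G ≡ score L w (restrict m G)
score-ones-++ zero    w G = refl
score-ones-++ (suc m) w G = trans (score-polar-head (ones m ++ w) G) (score-ones-++ m w (restrict 1 G))

score-extension : ∀ {L n} (m : ℕ) (w : Word n) (G : Fold L (m + n)) (F : Fold L n) →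
  Extends m G F → score L (ones m ++ w) G ≡ score L w F
score-extension m w G F G-extends-F =
  trans (score-ones-++ m w G) (score-cong w {restrict m G} {F} G-extends-F)

J-ones-++-≤ : ∀ {L n} (m : ℕ) (w : Word n) {j k : ℕ} →
  IsJ L (ones m ++ w) j → IsJ L w k → j ≤ k
J-ones-++-≤ {L} m w ((G , scoreG) , _) (_ , maximal) = begin
  _                            ≡⟨ scoreG ⟨
  score L (ones m ++ w) G      ≡⟨ score-ones-++ m w G ⟩
  score L w (restrict m G)     ≤⟨ maximal (restrict m G) ⟩
  _                            ∎
  where open ≤-Reasoning

theorem2p12 : (L : Lattice) (n m : ℕ) (x : Word n)
    (jx jx1 jmx jmx1 : ℕ)
    → IsJ L x jx → IsJ L (x ++ [ b1 ]) jx1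
    → IsJ L (ones m ++ x) jmx → IsJ L (ones m ++ x ++ [ b1 ]) jmx1
    → jx1 < jx
    → Σ (Fold L n) (λ F → score L x F ≡ jx × Σ (Fold L (m + n)) (λ G → Extends m G F))
    → jmx1 < jmx
theorem2p12 L n m x jx jx1 jmx jmx1 _ Jx1 Jmx Jmx1 jx1<jx (F , scoreF , G , G-extends-F) =
  <-≤-trans (≤-<-trans (J-ones-++-≤ m (x ++ [ b1 ]) Jmx1 Jx1) jx1<jx) jx≤jmx
  where
  open ≤-Reasoning
  jx≤jmx : jx ≤ jmx
  jx≤jmx = begin
    jx                        ≡⟨ scoreF ⟨
    score L x F               ≡⟨ score-extension m x G F G-extends-F ⟨
    score L (ones m ++ x) G   ≤⟨ proj₂ Jmx G ⟩
    jmx                       ∎
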